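{- Let $G$ be a DAG. If there exist $u,v\in V(G)$ with $|\mathrm{LCA}_G(\{u,v\})|\ge 2$, then $G$ contains a $K_{2,2}$-minor. In particular, there is a strict $K_{2,2}$-subdivision $H\subseteq G$ such that $R(H)\subseteq \mathrm{LCA}_G(\{u,v\})\cap\mathrm{LCA}_G(L(H))$.
   Context: A DAG is a finite directed graph without loops and directed cycles; $u\preceq_G v$ means there is a directed path from $v$ to $u$ (including $u=v$). $L(G)$ and $R(G)$ are the sets of $\preceq_G$-minimal and $\preceq_G$-maximal vertices. For non-empty $A\subseteq V(G)$, $\mathrm{LCA}_G(A)$ is the set of $\preceq_G$-minimal vertices $w$ with $a\preceq_G w$ for all $a\in A$. An edge-subdivision replaces an edge $(x,y)$ by $(x,z),(z,y)$ with a new vertex $z$; a subdivision of $F$ is obtained by a sequence of edge-subdivisions; $H\subseteq G$ is an $F$-subdivision if $H$ is a subgraph of $G$ isomorphic to a subdivision of $F$; $G$ contains an $F$-minor if it has an $F$-subdivision. $K_{2,2}$ is the DAG with vertices $r_1,r_2,l_1,l_2$ and edges $(r_i,l_j)$, $1\le i,j\le2$. A strict $K_{2,2}$-subdivision is a $K_{2,2}$-subdivision $H\subseteq G$ whose two roots are $\preceq_G$-incomparable and whose two leaves are $\preceq_G$-incomparable. -}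

module Defs where

open import Level using (0ℓ)
open import Data.Nat using (ℕ; suc)
open import Data.Fin using (Fin; zero; suc)
open import Data.Empty using (⊥)
open import Data.Unit using (⊤)
open import Data.Product using (_×_; ∃; ∃-syntax; _,_)
open import Data.Sum using (_⊎_)
open import Relation.Nullary using (¬_)
open import Relation.Unary using (Pred; _∈_; _⊆_; _∩_)
open import Relation.Binary.PropositionalEquality using (_≡_; _≢_)
open import Relation.Binary.Construct.Closure.ReflexiveTransitive using (Star)
open import Function.Definitions using (Injective)

record Graph : Set₁ where
  constructor graph
  field
    n : ℕ
    E : Fin n → Fin n → Set

open Graph public

V : Graph → Set
V G = Fin (n G)

-- u ⪯ v : there is a directed path from v to u (including u = v)
_⊢_⪯_ : (G : Graph) → V G → V G → Set
G ⊢ u ⪯ v = Star (E G) v u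

-- DAG: no loops and no directed cycles
-- (an edge (u , v) together with a path from v back to u would be a
--  directed cycle; u = v covers loops)
IsDAG : Graph → Set
IsDAG G = ∀ u v → E G u v → Star (E G) v u → ⊥

Lset : (G : Graph) → Pred (V G) 0ℓ
Lset G x = ∀ y → G ⊢ y ⪯ x → y ≡ x

Rset : (G : Graph) → Pred (V G) 0ℓ
Rset G x = ∀ y → G ⊢ x ⪯ y → y ≡ x

NonEmpty : ∀ {A : Set} → Pred A 0ℓ → Set
NonEmpty P = ∃ λ a → P a

IsCommonAncestor : (G : Graph) → Pred (V G) 0ℓ → Pred (V G) 0ℓ
IsCommonAncestor G A w = ∀ a → a ∈ A → G ⊢ a ⪯ w

LCA : (G : Graph) → Pred (V G) 0ℓ → Pred (V G) 0ℓ
LCA G A w = IsCommonAncestor G A w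
          × (∀ w′ → IsCommonAncestor G A w′ → G ⊢ w′ ⪯ w → w′ ≡ w)

pair : ∀ {A : Set} → A → A → Pred A 0ℓ
pair u v x = x ≡ u ⊎ x ≡ v

-- Edge-subdivision of the edge (x , y) of G: new vertex z is 'zero',
-- old vertex i is 'suc i'; edge (x,y) removed, edges (x,z),(z,y) added.
subdivideE : (G : Graph) → V G → V G → Fin (suc (n G)) → Fin (suc (n G)) → Set
subdivideE G x y (suc a) (suc b) = E G a b × ¬ (a ≡ x × b ≡ y)
subdivideE G x y (suc a) zero    = a ≡ x
subdivideE G x y zero    (suc b) = b ≡ y
subdivideE G x y zero    zero    = ⊥

subdivide : (G : Graph) → V G → V G → Graph
subdivide G x y = graph (suc (n G)) (subdivideE G x y)

data Subdivision (F : Graph) : Graph → Set₁ where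
  here : Subdivision F F
  step : ∀ {F′} (x y : V F′) → E F′ x y →
         Subdivision F F′ → Subdivision F (subdivide F′ x y)

-- An embedding of S as a subgraph H of G: an injective vertex map φ
-- sending edges to edges. H is the image subgraph (vertices φ(V S),
-- edges φ(E S)), which is isomorphic to S via φ.
record Embedding (S G : Graph) : Set where
  constructor emb
  field
    φ     : V S → V G
    inj   : Injective _≡_ _≡_ φ
    edges : ∀ a b → E S a b → E G (φ a) (φ b)

open Embedding public

record FSubdivisionIn (F G : Graph) : Set₁ where
  constructor fsub
  field
    S    : Graph
    sub  : Subdivision F S
    embd : Embedding S G

open FSubdivisionIn public

RH : ∀ {F G} → FSubdivisionIn F G → Pred (V G) 0ℓ
RH H x = ∃[ w ] (Rset (S H) w × φ (embd H) w ≡ x)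

LH : ∀ {F G} → FSubdivisionIn F G → Pred (V G) 0ℓ
LH H x = ∃[ w ] (Lset (S H) w × φ (embd H) w ≡ x)

HasMinor : Graph → Graph → Set₁
HasMinor G F = FSubdivisionIn F G

-- K_{2,2}: vertices r₁ = 0, r₂ = 1, l₁ = 2, l₂ = 3, edges (rᵢ , lⱼ)
K22E : Fin 4 → Fin 4 → Set
K22E zero          (suc (suc zero))       = ⊤
K22E zero          (suc (suc (suc zero))) = ⊤
K22E (suc zero)    (suc (suc zero))       = ⊤
K22E (suc zero)    (suc (suc (suc zero))) = ⊤
K22E _             _                      = ⊥

K22 : Graph
K22 = graph 4 K22E

Incomparable : (G : Graph) → V G → V G → Set
Incomparable G x y = ¬ (G ⊢ x ⪯ y) × ¬ (G ⊢ y ⪯ x)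

IsStrict : ∀ {G} → FSubdivisionIn K22 G → Set
IsStrict {G} H =
    (∀ x y → RH H x → RH H y → x ≢ y → Incomparable G x y)
  × (∀ x y → LH H x → LH H y → x ≢ y → Incomparable G x y)

-- Let a ≢ b be LCAs of u and v; they are incomparable.  Follow paths from a and
-- from b down to u, and let l₁ be the first vertex of the a-path lying on the
-- b-path; define l₂ likewise for v.  A vertex above both l₁ and l₂ is a common
-- ancestor of u and v, so none lies strictly below a or b.  This makes l₁, l₂
-- incomparable and the four segments a → lⱼ, b → lⱼ internally disjoint and
-- free of a, b, l₁, l₂ (two segments into the same lⱼ are disjoint by the choice
-- of lⱼ).  Subdividing K₂,₂ along them embeds it with roots a, b and leaves
-- l₁, l₂, and a, b are LCAs of {l₁, l₂} because every common ancestor of l₁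
-- and l₂ is a common ancestor of u and v.
module Submission where

open import Defs
open import Level using (0ℓ)
open import Function using (_∘_)
open import Function.Definitions using (Injective)
open import Data.Nat using (zero; suc; _+_; _≤_)
open import Data.Nat.Properties using (+-suc; m≤m+n; ≤-trans; <-irrefl)
open import Data.Fin using (zero; suc)
open import Data.Fin.Properties using (_≟_; any?; injective⇒≤)
open import Data.List using (List; []; _∷_; _++_)
open import Data.List.Membership.Propositional using (_∈_)
open import Data.List.Membership.Propositional.Properties using (∈-++⁺ˡ; ∈-++⁺ʳ)
open import Data.List.Relation.Unary.Any using (here; there)
import Data.List.Relation.Unary.Any as Any
open import Data.Empty using (⊥; ⊥-elim)
open import Data.Unit using (tt)
open import Data.Product using (_×_; Σ; ∃; ∃₂; ∃-syntax; _,_; proj₁; proj₂; swap)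
open import Data.Sum using (_⊎_; inj₁; inj₂)
open import Relation.Nullary using (¬_; Dec; yes; no)
open import Relation.Nullary.Decidable using (_×-dec_)
open import Relation.Unary using (Pred; _⊆_; _∩_)
open import Relation.Binary.Definitions using (DecidableEquality)
open import Relation.Binary.PropositionalEquality using (_≡_; _≢_; refl; sym; trans; cong; subst)
open import Relation.Binary.Construct.Closure.ReflexiveTransitive using (Star; ε; _◅_; _◅◅_)
open import Relation.Binary.Construct.Closure.Transitive using (TransClosure; [_]; _∷_)

data Path {A : Set} (R : A → A → Set) : A → List A → A → Set where
  [_] : ∀ {s t} → R s t → Path R s [] t
  _◅_ : ∀ {s p ps t} → R s p → Path R p ps t → Path R s (p ∷ ps) t

module _ {A : Set} {R : A → A → Set} where

  path⇒plus : ∀ {s ps t} → Path R s ps t → TransClosure R s t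
  path⇒plus [ e ]   = [ e ]
  path⇒plus (e ◅ p) = e ∷ path⇒plus p

  plus⇒star : ∀ {s t} → TransClosure R s t → Star R s t
  plus⇒star [ e ]   = e ◅ ε
  plus⇒star (e ∷ p) = e ◅ plus⇒star p

  path-edge : ∀ {s t} → Path R s [] t → R s t
  path-edge [ e ] = e

  path-uncons : ∀ {s p ps t} → Path R s (p ∷ ps) t → R s p × Path R p ps t
  path-uncons (e ◅ rest) = e , rest

  star⇒path : ∀ {s t} → Star R s t → s ≢ t → ∃ λ ps → Path R s ps t
  star⇒path ε          s≢s = ⊥-elim (s≢s refl)
  star⇒path (e ◅ rest) _   = extend e rest
    where
      extend : ∀ {s m t} → R s m → Star R m t → ∃ λ ps → Path R s ps t
      extend e ε           = [] , [ e ]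
      extend e (e′ ◅ rest) = let ps , path = extend e′ rest in _ ∷ ps , e ◅ path

  interior⇒plus : ∀ {s ps t z} → z ∈ ps → Path R s ps t →
                  TransClosure R s z × TransClosure R z t
  interior⇒plus (here refl) (e ◅ rest) = [ e ] , path⇒plus rest
  interior⇒plus (there z∈)  (e ◅ rest) =
    let s⁺z , z⁺t = interior⇒plus z∈ rest in e ∷ s⁺z , z⁺t

  path-prefix : ∀ {s ps t z} → z ∈ ps ++ t ∷ [] → Path R s ps t →
              ∃ λ qs → Path R s qs z × (∀ {y} → y ∈ qs → y ∈ ps)
  path-prefix (here refl)  [ e ]      = [] , [ e ] , λ ()
  path-prefix (there ())   [ _ ]
  path-prefix (here refl)  (e ◅ _)    = [] , [ e ] , λ ()
  path-prefix (there z∈)   (e ◅ rest) =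
    let qs , path , qs⊆ps = path-prefix z∈ rest
    in _ ∷ qs , e ◅ path , λ { (here refl) → here refl ; (there y∈) → there (qs⊆ps y∈) }

  path-first-hit : ∀ {Q : A → Set} → (∀ z → Dec (Q z)) → ∀ {s ps t} → Q t → Path R s ps t →
              ∃₂ λ m qs → Path R s qs m × Q m × (∀ {z} → z ∈ qs → ¬ Q z) × Star R m t
  path-first-hit Q? Qt [ e ] = _ , [] , [ e ] , Qt , (λ ()) , ε
  path-first-hit Q? Qt (_◅_ {p = p} e rest) with Q? p
  ... | yes Qp = p , [] , [ e ] , Qp , (λ ()) , plus⇒star (path⇒plus rest)
  ... | no ¬Qp =
    let m , qs , path , Qm , avoids , onward = path-first-hit Q? Qt rest
    in m , p ∷ qs , e ◅ path , Qm , (λ { (here refl) → ¬Qp ; (there z∈) → avoids z∈ }) , onward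

record Meeting {A : Set} (R : A → A → Set) (a b t : A) : Set where
  field
    point                       : A
    leftInterior rightInterior  : List A
    left                        : Path R a leftInterior point
    right                       : Path R b rightInterior point
    onward                      : Star R point t
    interiors-disjoint          : ∀ {z} → z ∈ leftInterior → z ∈ rightInterior → ⊥

meet : ∀ {A : Set} {R : A → A → Set} → DecidableEquality A →
       ∀ {a b t ps qs} → Path R a ps t → Path R b qs t → Meeting R a b t
meet _≟_ {t = t} {qs = qs} pa pb =
  let m , qa , left , m∈pb , avoids , onward =
        path-first-hit (λ z → Any.any? (z ≟_) (qs ++ t ∷ [])) (∈-++⁺ʳ qs (here refl)) pa
      qb , right , qb⊆qs = path-prefix m∈pb pb
  in record { point = m ; leftInterior = qa ; rightInterior = qb
            ; left = left ; right = right ; onward = onward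
            ; interiors-disjoint = λ z∈qa z∈qb → avoids z∈qa (∈-++⁺ˡ (qb⊆qs z∈qb)) }

module _ {G : Graph} (dag : IsDAG G) where

  acyclic : ∀ {s t} → TransClosure (E G) s t → ¬ Star (E G) t s
  acyclic [ e ]   back = dag _ _ e back
  acyclic (e ∷ p) back = dag _ _ e (plus⇒star p ◅◅ back)

  plus⇒≢ : ∀ {s t} → TransClosure (E G) s t → s ≢ t
  plus⇒≢ s⁺s refl = acyclic s⁺s ε

incomparable⇒≢ : ∀ {G x y} → Incomparable G x y → x ≢ y
incomparable⇒≢ (x⋠y , _) refl = x⋠y ε

Antichain : (G : Graph) → Pred (V G) 0ℓ → Set
Antichain G P = ∀ x y → P x → P y → x ≢ y → Incomparable G x y

module _ {G : Graph} where

  pair-antichain : ∀ {a b} → Incomparable G a b → Antichain G (pair a b)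
  pair-antichain _   _ _ (inj₁ refl) (inj₁ refl) x≢x = ⊥-elim (x≢x refl)
  pair-antichain a∥b _ _ (inj₁ refl) (inj₂ refl) _   = a∥b
  pair-antichain a∥b _ _ (inj₂ refl) (inj₁ refl) _   = swap a∥b
  pair-antichain _   _ _ (inj₂ refl) (inj₂ refl) x≢x = ⊥-elim (x≢x refl)

  antichain-⊆ : ∀ {P Q : Pred (V G) 0ℓ} → P ⊆ Q → Antichain G Q → Antichain G P
  antichain-⊆ P⊆Q anti x y Px Py = anti x y (P⊆Q Px) (P⊆Q Py)

  antichain-¬plus : IsDAG G → ∀ {P x y} → Antichain G P → P x → P y →
                    ¬ TransClosure (E G) y x
  antichain-¬plus dag anti Px Py y⁺x =
    proj₁ (anti _ _ Px Py (plus⇒≢ dag y⁺x ∘ sym)) (plus⇒star y⁺x)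

  pair-common : ∀ {u v w} → G ⊢ u ⪯ w → G ⊢ v ⪯ w → IsCommonAncestor G (pair u v) w
  pair-common u⪯w _   _ (inj₁ refl) = u⪯w
  pair-common _   v⪯w _ (inj₂ refl) = v⪯w

  lca-⪯⇒≡ : ∀ {A a b} → LCA G A a → LCA G A b → G ⊢ a ⪯ b → a ≡ b
  lca-⪯⇒≡ (a-common , _) (_ , b-minimal) = b-minimal _ a-common

  lca-inherit : ∀ {A B r} → IsCommonAncestor G B ⊆ IsCommonAncestor G A →
                LCA G A r → IsCommonAncestor G B r → LCA G B r
  lca-inherit B⇒A (_ , minimal) r-common = r-common , λ w w-common → minimal w (B⇒A w-common)

branch : ∀ {F S} → Subdivision F S → V F → V S
branch here           i = i
branch (step _ _ _ σ) i = suc (branch σ i)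

Source Sink : (S : Graph) → V S → Set
Source S w = ∀ c → ¬ E S c w
Sink   S w = ∀ d → ¬ E S w d

subdivide-edge : ∀ {S} (x y : V S) {c d} → E S c d →
                 E (subdivide S x y) (suc c) (suc d) ⊎ (c ≡ x × d ≡ y)
subdivide-edge x y {c} {d} e with c ≟ x ×-dec d ≟ y
... | yes c,d≡x,y = inj₂ c,d≡x,y
... | no  c,d≢x,y = inj₁ (e , c,d≢x,y)

source-branch : ∀ {F S w} (σ : Subdivision F S) → Source S w →
                ∃ λ i → Source F i × branch σ i ≡ w
source-branch here src = _ , src , refl
source-branch {w = zero}  (step x y _ σ) src = ⊥-elim (src (suc x) refl)
source-branch {w = suc w} (step {T} x y _ σ) src =
  let i , srcᵢ , i↦w = source-branch σ src′ in i , srcᵢ , cong suc i↦w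
  where
    src′ : Source T w
    src′ c c→w with subdivide-edge {T} x y c→w
    ... | inj₁ e          = src (suc c) e
    ... | inj₂ (_ , refl) = src zero refl

sink-branch : ∀ {F S w} (σ : Subdivision F S) → Sink S w →
              ∃ λ i → Sink F i × branch σ i ≡ w
sink-branch here snk = _ , snk , refl
sink-branch {w = zero}  (step x y _ σ) snk = ⊥-elim (snk (suc y) refl)
sink-branch {w = suc w} (step {T} x y _ σ) snk =
  let i , snkᵢ , i↦w = sink-branch σ snk′ in i , snkᵢ , cong suc i↦w
  where
    snk′ : Sink T w
    snk′ d w→d with subdivide-edge {T} x y w→d
    ... | inj₁ e          = snk (suc d) e
    ... | inj₂ (refl , _) = snk zero refl

branch-sink : ∀ {F S i} (σ : Subdivision F S) → Sink F i → Sink S (branch σ i)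
branch-sink here snk = snk
branch-sink (step {T} x y x→y σ) snk zero i↦x =
  branch-sink σ snk y (subst (λ w → E T w y) (sym i↦x) x→y)
branch-sink (step x y x→y σ) snk (suc d) (e , _) = branch-sink σ snk d e

module _ {S : Graph} (loopless : ∀ w → ¬ E S w w) where

  Rset⇒source : ∀ {w} → Rset S w → Source S w
  Rset⇒source {w} minimal c c→w =
    loopless w (subst (λ c → E S c w) (minimal c (c→w ◅ ε)) c→w)

  Lset⇒sink : ∀ {w} → Lset S w → Sink S w
  Lset⇒sink {w} maximal d w→d =
    loopless w (subst (E S w) (maximal d (w→d ◅ ε)) w→d)

sink⇒Lset : ∀ {S w} → Sink S w → Lset S w
sink⇒Lset snk _ ε         = refl
sink⇒Lset snk _ (w→d ◅ _) = ⊥-elim (snk _ w→d)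

-- route c d lists the interior vertices of the path of G that stands in for
-- the edge (c , d) of S; an edge with an empty route is already an edge of G.
record Routing (S G : Graph) : Set where
  field
    vertex           : V S → V G
    vertex-injective : Injective _≡_ _≡_ vertex
    route            : V S → V S → List (V G)
    route-path       : ∀ {c d} → E S c d → Path (E G) (vertex c) (route c d) (vertex d)
    routed⇒edge      : ∀ {c d z} → z ∈ route c d → E S c d
    route-fresh      : ∀ {c d z} i → z ∈ route c d → vertex i ≢ z
    routes-disjoint  : ∀ {c d c′ d′ z} → z ∈ route c d → z ∈ route c′ d′ → c ≡ c′ × d ≡ d′

module SubdivideAlongRoute {S G : Graph} (dag : IsDAG G) (ρ : Routing S G)
                           {x y : V S} {p : V G} {ps : List (V G)}
                           (route≡ : Routing.route ρ x y ≡ p ∷ ps) where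
  open Routing ρ

  S′ : Graph
  S′ = subdivide S x y

  ∈route-xy : ∀ {z} → z ∈ p ∷ ps → z ∈ route x y
  ∈route-xy = subst (_ ∈_) (sym route≡)

  x→y : E S x y
  x→y = routed⇒edge (∈route-xy (here refl))

  xy-path : Path (E G) (vertex x) (p ∷ ps) (vertex y)
  xy-path = subst (λ qs → Path (E G) (vertex x) qs (vertex y)) route≡ (route-path x→y)

  p∉ps : ∀ {z} → z ∈ ps → p ≢ z
  p∉ps z∈ refl = acyclic dag (proj₁ (interior⇒plus z∈ (proj₂ (path-uncons xy-path)))) ε

  vertex′ : V S′ → V G
  vertex′ zero    = p
  vertex′ (suc i) = vertex i

  route′ : V S′ → V S′ → List (V G)
  route′ _       zero    = []
  route′ zero    (suc d) with d ≟ y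
  ... | yes _ = ps
  ... | no  _ = []
  route′ (suc c) (suc d) with c ≟ x ×-dec d ≟ y
  ... | yes _ = []
  ... | no  _ = route c d

  route′-kept : ∀ {c d} → ¬ (c ≡ x × d ≡ y) → route′ (suc c) (suc d) ≡ route c d
  route′-kept {c} {d} c,d≢x,y with c ≟ x ×-dec d ≟ y
  ... | yes c,d≡x,y = ⊥-elim (c,d≢x,y c,d≡x,y)
  ... | no  _       = refl

  route′-rest : route′ zero (suc y) ≡ ps
  route′-rest with y ≟ y
  ... | yes _   = refl
  ... | no  y≢y = ⊥-elim (y≢y refl)

  data Rerouted (z : V G) : V S′ → V S′ → Set where
    kept : ∀ {c d} → ¬ (c ≡ x × d ≡ y) → z ∈ route c d → Rerouted z (suc c) (suc d)
    rest : z ∈ ps → Rerouted z zero (suc y)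

  rerouted : ∀ {c d z} → z ∈ route′ c d → Rerouted z c d
  rerouted {zero}  {suc d} z∈ with d ≟ y
  ... | yes refl = rest z∈
  rerouted {zero}  {suc d} () | no _
  rerouted {suc c} {suc d} z∈ with c ≟ x ×-dec d ≟ y
  ... | no c,d≢x,y = kept c,d≢x,y z∈
  rerouted {suc c} {suc d} () | yes _

  vertex′-injective : Injective _≡_ _≡_ vertex′
  vertex′-injective {zero}  {zero}  _   = refl
  vertex′-injective {zero}  {suc j} p≡  = ⊥-elim (route-fresh j (∈route-xy (here refl)) (sym p≡))
  vertex′-injective {suc i} {zero}  ≡p  = ⊥-elim (route-fresh i (∈route-xy (here refl)) ≡p)
  vertex′-injective {suc i} {suc j} eq  = cong suc (vertex-injective eq)

  route′-path : ∀ {c d} → E S′ c d → Path (E G) (vertex′ c) (route′ c d) (vertex′ d)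
  route′-path {suc c} {suc d} (e , c,d≢x,y) rewrite route′-kept c,d≢x,y = route-path e
  route′-path {suc c} {zero}  refl = [ proj₁ (path-uncons xy-path) ]
  route′-path {zero}  {suc d} refl rewrite route′-rest = proj₂ (path-uncons xy-path)

  rerouted⇒edge : ∀ {c d z} → Rerouted z c d → E S′ c d
  rerouted⇒edge (kept c,d≢x,y z∈) = routed⇒edge z∈ , c,d≢x,y
  rerouted⇒edge (rest _)          = refl

  rerouted-fresh : ∀ {c d z} i → Rerouted z c d → vertex′ i ≢ z
  rerouted-fresh zero    (kept c,d≢x,y z∈) p≡z =
    c,d≢x,y (routes-disjoint z∈ (∈route-xy (here (sym p≡z))))
  rerouted-fresh (suc i) (kept _ z∈)       = route-fresh i z∈
  rerouted-fresh zero    (rest z∈)         = p∉ps z∈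
  rerouted-fresh (suc i) (rest z∈)         = route-fresh i (∈route-xy (there z∈))

  rerouted-disjoint : ∀ {c d c′ d′ z} → Rerouted z c d → Rerouted z c′ d′ → c ≡ c′ × d ≡ d′
  rerouted-disjoint (kept _ z∈) (kept _ z∈′) =
    let c≡c′ , d≡d′ = routes-disjoint z∈ z∈′ in cong suc c≡c′ , cong suc d≡d′
  rerouted-disjoint (kept c,d≢x,y z∈) (rest z∈′) =
    ⊥-elim (c,d≢x,y (routes-disjoint z∈ (∈route-xy (there z∈′))))
  rerouted-disjoint (rest z∈) (kept c,d≢x,y z∈′) =
    ⊥-elim (c,d≢x,y (routes-disjoint z∈′ (∈route-xy (there z∈))))
  rerouted-disjoint (rest _) (rest _) = refl , refl

  routing′ : Routing S′ G
  routing′ = record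
    { vertex           = vertex′
    ; vertex-injective = vertex′-injective
    ; route            = route′
    ; route-path       = route′-path
    ; routed⇒edge      = λ {c} {d} z∈ → rerouted⇒edge (rerouted {c} {d} z∈)
    ; route-fresh      = λ {c} {d} i z∈ → rerouted-fresh i (rerouted {c} {d} z∈)
    ; routes-disjoint  = λ {c} {d} {c′} {d′} z∈ z∈′ →
                           rerouted-disjoint (rerouted {c} {d} z∈) (rerouted {c′} {d′} z∈′)
    }

module _ {A : Set} where

  IsCons : List A → Set
  IsCons xs = ∃₂ λ p ps → xs ≡ p ∷ ps

  isCons? : ∀ xs → Dec (IsCons xs)
  isCons? []       = no λ ()
  isCons? (p ∷ ps) = yes (p , ps , refl)

  ¬isCons⇒[] : ∀ {xs} → ¬ IsCons xs → xs ≡ []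
  ¬isCons⇒[] {[]}     _     = refl
  ¬isCons⇒[] {p ∷ ps} ¬cons = ⊥-elim (¬cons (p , ps , refl))

Realises : ∀ {F G S} → FSubdivisionIn F G → Subdivision F S → (V S → V G) → Set
Realises H σ f = ∀ i → φ (embd H) (branch (sub H) i) ≡ f (branch σ i)

module _ {F G : Graph} (dag : IsDAG G) where

  -- Each subdivision places one more vertex of G injectively, so the fuel k
  -- with n G ≤ k + n S cannot run out while some route is non-empty.
  realise : ∀ {S} k → n G ≤ k + n S → (σ : Subdivision F S) (ρ : Routing S G) →
            Σ (FSubdivisionIn F G) λ H → Realises H σ (Routing.vertex ρ)
  realise {S} k bound σ ρ with any? (λ c → any? λ d → isCons? (Routing.route ρ c d))
  ... | no unrouted = fsub S σ (emb vertex vertex-injective direct) , λ _ → refl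
    where
      open Routing ρ
      direct : ∀ c d → E S c d → E G (vertex c) (vertex d)
      direct c d e = path-edge (subst (λ qs → Path (E G) (vertex c) qs (vertex d))
                                      (¬isCons⇒[] λ routed → unrouted (c , d , routed))
                                      (route-path e))
  ... | yes (x , y , p , ps , route≡) = subdivide-next k bound
    where
      open SubdivideAlongRoute dag ρ route≡
      subdivide-next : ∀ k → n G ≤ k + n S →
                       Σ (FSubdivisionIn F G) λ H → Realises H σ (Routing.vertex ρ)
      subdivide-next zero    bound =
        ⊥-elim (<-irrefl refl (≤-trans (injective⇒≤ vertex′-injective) bound))
      subdivide-next (suc k) bound =
        realise k (subst (n G ≤_) (sym (+-suc k _)) bound) (step x y x→y σ) routing′

  routing⇒subdivision : (ρ : Routing F G) →
                        Σ (FSubdivisionIn F G) λ H → Realises H here (Routing.vertex ρ)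
  routing⇒subdivision = realise (n G) (m≤m+n (n G) (n F)) here

module BranchVertices {F G : Graph} (dag : IsDAG G) (H : FSubdivisionIn F G)
                      {f : V F → V G} (branch↦f : Realises H here f) where

  loopless : ∀ w → ¬ E (S H) w w
  loopless w e = dag _ _ (edges (embd H) w w e) ε

  RH⊆ : ∀ {P : Pred (V G) 0ℓ} → (∀ {i} → Source F i → P (f i)) → RH H ⊆ P
  RH⊆ {P} sources⊆P (w , minimal , refl) =
    let i , srcᵢ , i↦w = source-branch (sub H) (Rset⇒source loopless minimal)
    in subst P (trans (sym (branch↦f i)) (cong (φ (embd H)) i↦w)) (sources⊆P srcᵢ)

  LH⊆ : ∀ {P : Pred (V G) 0ℓ} → (∀ {i} → Sink F i → P (f i)) → LH H ⊆ P
  LH⊆ {P} sinks⊆P (w , maximal , refl) =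
    let i , snkᵢ , i↦w = sink-branch (sub H) (Lset⇒sink loopless maximal)
    in subst P (trans (sym (branch↦f i)) (cong (φ (embd H)) i↦w)) (sinks⊆P snkᵢ)

  sink⇒LH : ∀ {i} → Sink F i → LH H (f i)
  sink⇒LH {i} snk = branch (sub H) i , sink⇒Lset (branch-sink (sub H) snk) , branch↦f i

pattern root₁ = zero
pattern root₂ = suc zero
pattern leaf₁ = suc (suc zero)
pattern leaf₂ = suc (suc (suc zero))

K22-edge-ends : ∀ {c d} → E K22 c d → pair root₁ root₂ c × pair leaf₁ leaf₂ d
K22-edge-ends {root₁} {leaf₁} _ = inj₁ refl , inj₁ refl
K22-edge-ends {root₁} {leaf₂} _ = inj₁ refl , inj₂ refl
K22-edge-ends {root₂} {leaf₁} _ = inj₂ refl , inj₁ refl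
K22-edge-ends {root₂} {leaf₂} _ = inj₂ refl , inj₂ refl
K22-edge-ends {root₁} {root₁} ()
K22-edge-ends {root₁} {root₂} ()
K22-edge-ends {root₂} {root₁} ()
K22-edge-ends {root₂} {root₂} ()
K22-edge-ends {suc (suc _)} ()

module TwoLCAs {G : Graph} (dag : IsDAG G) {u v a b : V G} (a≢b : a ≢ b)
               (La : LCA G (pair u v) a) (Lb : LCA G (pair u v) b) where

  _⪯_ _≺_ : V G → V G → Set
  x ⪯ y = G ⊢ x ⪯ y
  x ≺ y = TransClosure (E G) y x

  Root : Pred (V G) 0ℓ
  Root = pair a b

  root-LCA : ∀ {r} → Root r → LCA G (pair u v) r
  root-LCA (inj₁ refl) = La
  root-LCA (inj₂ refl) = Lb

  roots-incomparable : Incomparable G a b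
  roots-incomparable = a≢b ∘ lca-⪯⇒≡ La Lb , a≢b ∘ sym ∘ lca-⪯⇒≡ Lb La

  roots-antichain : Antichain G Root
  roots-antichain = pair-antichain roots-incomparable

  target-not-root : ∀ {t} → pair u v t → ¬ Root t
  target-not-root t∈ (inj₁ refl) = proj₁ roots-incomparable (proj₁ Lb _ t∈)
  target-not-root t∈ (inj₂ refl) = proj₂ roots-incomparable (proj₁ La _ t∈)

  root-path : ∀ {r t} → Root r → pair u v t → ∃ λ ps → Path (E G) r ps t
  root-path r∈ t∈ =
    star⇒path (proj₁ (root-LCA r∈) _ t∈) (λ r≡t → target-not-root t∈ (subst Root r≡t r∈))

  meeting : ∀ {t} → pair u v t → Meeting (E G) a b t
  meeting t∈ = meet _≟_ (proj₂ (root-path (inj₁ refl) t∈)) (proj₂ (root-path (inj₂ refl) t∈))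

  module M₁ = Meeting (meeting {u} (inj₁ refl))
  module M₂ = Meeting (meeting {v} (inj₂ refl))

  l₁ l₂ : V G
  l₁ = M₁.point
  l₂ = M₂.point

  Leaf : Pred (V G) 0ℓ
  Leaf = pair l₁ l₂

  common : ∀ {z} → l₁ ⪯ z → l₂ ⪯ z → IsCommonAncestor G (pair u v) z
  common l₁⪯z l₂⪯z = pair-common (l₁⪯z ◅◅ M₁.onward) (l₂⪯z ◅◅ M₂.onward)

  not-above-both : ∀ {r z} → Root r → z ≺ r → l₁ ⪯ z → l₂ ⪯ z → ⊥
  not-above-both r∈ z≺r l₁⪯z l₂⪯z =
    plus⇒≢ dag z≺r (sym (proj₂ (root-LCA r∈) _ (common l₁⪯z l₂⪯z) (plus⇒star z≺r)))

  leaf≺root : ∀ {r l} → Root r → Leaf l → l ≺ r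
  leaf≺root (inj₁ refl) (inj₁ refl) = path⇒plus M₁.left
  leaf≺root (inj₂ refl) (inj₁ refl) = path⇒plus M₁.right
  leaf≺root (inj₁ refl) (inj₂ refl) = path⇒plus M₂.left
  leaf≺root (inj₂ refl) (inj₂ refl) = path⇒plus M₂.right

  leaves-incomparable : Incomparable G l₁ l₂
  leaves-incomparable =
      (λ l₁⪯l₂ → not-above-both (inj₁ refl) (leaf≺root (inj₁ refl) (inj₂ refl)) l₁⪯l₂ ε)
    , (λ l₂⪯l₁ → not-above-both (inj₁ refl) (leaf≺root (inj₁ refl) (inj₁ refl)) ε l₂⪯l₁)

  leaves-antichain : Antichain G Leaf
  leaves-antichain = pair-antichain leaves-incomparable

  root≢leaf : ∀ {r l} → Root r → Leaf l → r ≢ l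
  root≢leaf r∈ l∈ = plus⇒≢ dag (leaf≺root r∈ l∈)

  vertex₀ : V K22 → V G
  vertex₀ root₁ = a
  vertex₀ root₂ = b
  vertex₀ leaf₁ = l₁
  vertex₀ leaf₂ = l₂

  vertex₀-injective : Injective _≡_ _≡_ vertex₀
  vertex₀-injective {root₁} {root₁} _ = refl
  vertex₀-injective {root₂} {root₂} _ = refl
  vertex₀-injective {leaf₁} {leaf₁} _ = refl
  vertex₀-injective {leaf₂} {leaf₂} _ = refl
  vertex₀-injective {root₁} {root₂} = ⊥-elim ∘ a≢b
  vertex₀-injective {root₂} {root₁} = ⊥-elim ∘ a≢b ∘ sym
  vertex₀-injective {leaf₁} {leaf₂} = ⊥-elim ∘ incomparable⇒≢ leaves-incomparable
  vertex₀-injective {leaf₂} {leaf₁} = ⊥-elim ∘ incomparable⇒≢ leaves-incomparable ∘ sym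
  vertex₀-injective {root₁} {leaf₁} = ⊥-elim ∘ root≢leaf (inj₁ refl) (inj₁ refl)
  vertex₀-injective {root₁} {leaf₂} = ⊥-elim ∘ root≢leaf (inj₁ refl) (inj₂ refl)
  vertex₀-injective {root₂} {leaf₁} = ⊥-elim ∘ root≢leaf (inj₂ refl) (inj₁ refl)
  vertex₀-injective {root₂} {leaf₂} = ⊥-elim ∘ root≢leaf (inj₂ refl) (inj₂ refl)
  vertex₀-injective {leaf₁} {root₁} = ⊥-elim ∘ root≢leaf (inj₁ refl) (inj₁ refl) ∘ sym
  vertex₀-injective {leaf₂} {root₁} = ⊥-elim ∘ root≢leaf (inj₁ refl) (inj₂ refl) ∘ sym
  vertex₀-injective {leaf₁} {root₂} = ⊥-elim ∘ root≢leaf (inj₂ refl) (inj₁ refl) ∘ sym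
  vertex₀-injective {leaf₂} {root₂} = ⊥-elim ∘ root≢leaf (inj₂ refl) (inj₂ refl) ∘ sym

  route₀ : V K22 → V K22 → List (V G)
  route₀ root₁ leaf₁ = M₁.leftInterior
  route₀ root₂ leaf₁ = M₁.rightInterior
  route₀ root₁ leaf₂ = M₂.leftInterior
  route₀ root₂ leaf₂ = M₂.rightInterior
  route₀ _     _     = []

  route₀-path : ∀ {c d} → E K22 c d → Path (E G) (vertex₀ c) (route₀ c d) (vertex₀ d)
  route₀-path e with K22-edge-ends e
  ... | inj₁ refl , inj₁ refl = M₁.left
  ... | inj₂ refl , inj₁ refl = M₁.right
  ... | inj₁ refl , inj₂ refl = M₂.left
  ... | inj₂ refl , inj₂ refl = M₂.right

  routed₀⇒edge : ∀ {c d z} → z ∈ route₀ c d → E K22 c d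
  routed₀⇒edge {root₁} {leaf₁} _ = tt
  routed₀⇒edge {root₁} {leaf₂} _ = tt
  routed₀⇒edge {root₂} {leaf₁} _ = tt
  routed₀⇒edge {root₂} {leaf₂} _ = tt
  routed₀⇒edge {root₁} {root₁} ()
  routed₀⇒edge {root₁} {root₂} ()
  routed₀⇒edge {root₂} {root₁} ()
  routed₀⇒edge {root₂} {root₂} ()
  routed₀⇒edge {suc (suc _)} ()

  vertex₀-kind : ∀ i → Root (vertex₀ i) ⊎ Leaf (vertex₀ i)
  vertex₀-kind root₁ = inj₁ (inj₁ refl)
  vertex₀-kind root₂ = inj₁ (inj₂ refl)
  vertex₀-kind leaf₁ = inj₂ (inj₁ refl)
  vertex₀-kind leaf₂ = inj₂ (inj₂ refl)

  root-vertex : ∀ {c} → pair root₁ root₂ c → Root (vertex₀ c)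
  root-vertex (inj₁ refl) = inj₁ refl
  root-vertex (inj₂ refl) = inj₂ refl

  leaf-vertex : ∀ {d} → pair leaf₁ leaf₂ d → Leaf (vertex₀ d)
  leaf-vertex (inj₁ refl) = inj₁ refl
  leaf-vertex (inj₂ refl) = inj₂ refl

  module _ (c d : V K22) {z} (z∈ : z ∈ route₀ c d) where

    routed-root : Root (vertex₀ c)
    routed-root = root-vertex (proj₁ (K22-edge-ends (routed₀⇒edge {c} {d} z∈)))

    routed-leaf : Leaf (vertex₀ d)
    routed-leaf = leaf-vertex (proj₂ (K22-edge-ends (routed₀⇒edge {c} {d} z∈)))

    routed-bounds : z ≺ vertex₀ c × vertex₀ d ≺ z
    routed-bounds = interior⇒plus z∈ (route₀-path {c} {d} (routed₀⇒edge z∈))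

  route₀-fresh : ∀ {c d z} i → z ∈ route₀ c d → vertex₀ i ≢ z
  route₀-fresh {c} {d} i z∈ i≡z with vertex₀-kind i
  ... | inj₁ i-root = antichain-¬plus dag roots-antichain (subst Root i≡z i-root)
                        (routed-root c d z∈) (proj₁ (routed-bounds c d z∈))
  ... | inj₂ i-leaf = antichain-¬plus dag leaves-antichain (routed-leaf c d z∈)
                        (subst Leaf i≡z i-leaf) (proj₂ (routed-bounds c d z∈))

  crossing : ∀ c c′ {z} → z ∈ route₀ c leaf₁ → z ∈ route₀ c′ leaf₂ → ⊥
  crossing c c′ z∈ z∈′ =
    not-above-both (routed-root c leaf₁ z∈) (proj₁ (routed-bounds c leaf₁ z∈))
      (plus⇒star (proj₂ (routed-bounds c leaf₁ z∈)))
      (plus⇒star (proj₂ (routed-bounds c′ leaf₂ z∈′)))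

  same-leaf : ∀ {c d c′ d′ z} → z ∈ route₀ c d → z ∈ route₀ c′ d′ → d ≡ d′
  same-leaf {c} {d} {c′} {d′} z∈ z∈′
    with K22-edge-ends (routed₀⇒edge {c} {d} z∈) | K22-edge-ends (routed₀⇒edge {c′} {d′} z∈′)
  ... | _ , inj₁ refl | _ , inj₁ refl = refl
  ... | _ , inj₂ refl | _ , inj₂ refl = refl
  ... | _ , inj₁ refl | _ , inj₂ refl = ⊥-elim (crossing c c′ z∈ z∈′)
  ... | _ , inj₂ refl | _ , inj₁ refl = ⊥-elim (crossing c′ c z∈′ z∈)

  same-root : ∀ {c c′ d z} → z ∈ route₀ c d → z ∈ route₀ c′ d → c ≡ c′
  same-root {c} {c′} {d} z∈ z∈′
    with K22-edge-ends (routed₀⇒edge {c} {d} z∈) | K22-edge-ends (routed₀⇒edge {c′} {d} z∈′)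
  ... | inj₁ refl , _         | inj₁ refl , _ = refl
  ... | inj₂ refl , _         | inj₂ refl , _ = refl
  ... | inj₁ refl , inj₁ refl | inj₂ refl , _ = ⊥-elim (M₁.interiors-disjoint z∈ z∈′)
  ... | inj₁ refl , inj₂ refl | inj₂ refl , _ = ⊥-elim (M₂.interiors-disjoint z∈ z∈′)
  ... | inj₂ refl , inj₁ refl | inj₁ refl , _ = ⊥-elim (M₁.interiors-disjoint z∈′ z∈)
  ... | inj₂ refl , inj₂ refl | inj₁ refl , _ = ⊥-elim (M₂.interiors-disjoint z∈′ z∈)

  routes₀-disjoint : ∀ {c d c′ d′ z} → z ∈ route₀ c d → z ∈ route₀ c′ d′ → c ≡ c′ × d ≡ d′
  routes₀-disjoint {c} {d} {c′} {d′} z∈ z∈′ with same-leaf {c} {d} {c′} {d′} z∈ z∈′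
  ... | refl = same-root {c} {c′} {d} z∈ z∈′ , refl

  routing₀ : Routing K22 G
  routing₀ = record
    { vertex           = vertex₀
    ; vertex-injective = vertex₀-injective
    ; route            = route₀
    ; route-path       = route₀-path
    ; routed⇒edge      = λ {c} {d} → routed₀⇒edge {c} {d}
    ; route-fresh      = λ {c} {d} → route₀-fresh {c} {d}
    ; routes-disjoint  = λ {c} {d} {c′} {d′} → routes₀-disjoint {c} {d} {c′} {d′}
    }

  source⇒root : ∀ {i} → Source K22 i → Root (vertex₀ i)
  source⇒root {root₁} _   = inj₁ refl
  source⇒root {root₂} _   = inj₂ refl
  source⇒root {leaf₁} src = ⊥-elim (src root₁ tt)
  source⇒root {leaf₂} src = ⊥-elim (src root₁ tt)

  sink⇒leaf : ∀ {i} → Sink K22 i → Leaf (vertex₀ i)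
  sink⇒leaf {root₁} snk = ⊥-elim (snk leaf₁ tt)
  sink⇒leaf {root₂} snk = ⊥-elim (snk leaf₁ tt)
  sink⇒leaf {leaf₁} _   = inj₁ refl
  sink⇒leaf {leaf₂} _   = inj₂ refl

lemma4p2 : (G : Graph) → IsDAG G → (u v : V G) →
           (∃[ a ] ∃[ b ] (a ≢ b × LCA G (pair u v) a × LCA G (pair u v) b)) →
           HasMinor G K22
             × Σ (FSubdivisionIn K22 G) (λ H →
                 IsStrict H × (RH H ⊆ (LCA G (pair u v) ∩ LCA G (LH H))))
lemma4p2 G dag u v (a , b , a≢b , La , Lb) = H , H , strict , roots⊆LCAs
  where
    open TwoLCAs dag a≢b La Lb

    realisation : Σ (FSubdivisionIn K22 G) λ H → Realises H here vertex₀
    realisation = routing⇒subdivision dag routing₀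

    H : FSubdivisionIn K22 G
    H = proj₁ realisation

    open BranchVertices dag H (proj₂ realisation)

    roots⊆ : RH H ⊆ Root
    roots⊆ = RH⊆ source⇒root

    leaves⊆ : LH H ⊆ Leaf
    leaves⊆ = LH⊆ sink⇒leaf

    strict : IsStrict H
    strict = antichain-⊆ roots⊆ roots-antichain , antichain-⊆ leaves⊆ leaves-antichain

    leaves-cover : IsCommonAncestor G (LH H) ⊆ IsCommonAncestor G (pair u v)
    leaves-cover w-common =
      common (w-common l₁ (sink⇒LH {leaf₁} λ _ ())) (w-common l₂ (sink⇒LH {leaf₂} λ _ ()))

    roots⊆LCAs : RH H ⊆ (LCA G (pair u v) ∩ LCA G (LH H))
    roots⊆LCAs x∈ =
      let x-root = roots⊆ x∈
          leaves⪯x l l∈ = plus⇒star (leaf≺root x-root (leaves⊆ l∈))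
      in root-LCA x-root , lca-inherit leaves-cover (root-LCA x-root) leaves⪯x
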